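{- Let $M\in\mathbb{Z}^{m\times n}$ be a minimal matrix, and let $M^1,\dots,M^n$ denote its columns. Then $M^1\le M^2\le\cdots\le M^n$, where columns (as vectors in $\mathbb{Z}^m$, top entry first) are compared lexicographically.
   Context: Integer vectors are ordered lexicographically: $v<w$ iff there is $j$ with $v_i=w_i$ for all $i<j$ and $v_j<w_j$. The row-lex ordering $\le_R$ on $\mathbb{Z}^{m\times n}$ is the lexicographic extension of this ordering to matrices viewed as the sequence of their rows (first row most significant). Two matrices in $\mathbb{Z}^{m\times n}$ are Hadamard equivalent if one can be obtained from the other by a sequence of the operations: multiplying a row or a column by $-1$; swapping two rows or two columns. A matrix $M$ is minimal if it equals the $\le_R$-minimum of its Hadamard equivalence class. -}

module Defs where

open import Data.Nat using (ℕ; zero; suc; _<_)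
open import Data.Integer as ℤ using (ℤ; -_)
open import Data.Product using (_×_; _,_)
open import Data.Sum using (_⊎_)
open import Relation.Binary.PropositionalEquality using (_≡_)
open import Data.Fin using (Fin; _≟_)
open import Relation.Nullary using (yes; no)

Matrix : ℕ → ℕ → Set
Matrix m n = Fin m → Fin n → ℤ

LexLe : {A : Set} (_≈_ _≺_ : A → A → Set) {k : ℕ} → (Fin k → A) → (Fin k → A) → Set
LexLe _≈_ _≺_ {zero}  v w = Data.Unit.⊤ where import Data.Unit
LexLe _≈_ _≺_ {suc k} v w =
  (v Fin.zero ≺ w Fin.zero) ⊎
  ((v Fin.zero ≈ w Fin.zero) × LexLe _≈_ _≺_ (λ i → v (Fin.suc i)) (λ i → w (Fin.suc i)))
  where import Data.Fin as Fin

LexLt : {A : Set} (_≈_ _≺_ : A → A → Set) {k : ℕ} → (Fin k → A) → (Fin k → A) → Set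
LexLt _≈_ _≺_ {zero}  v w = Data.Empty.⊥ where import Data.Empty
LexLt _≈_ _≺_ {suc k} v w =
  (v Fin.zero ≺ w Fin.zero) ⊎
  ((v Fin.zero ≈ w Fin.zero) × LexLt _≈_ _≺_ (λ i → v (Fin.suc i)) (λ i → w (Fin.suc i)))
  where import Data.Fin as Fin

_≤V_ : {k : ℕ} → (Fin k → ℤ) → (Fin k → ℤ) → Set
_≤V_ = LexLe _≡_ ℤ._<_

_<V_ : {k : ℕ} → (Fin k → ℤ) → (Fin k → ℤ) → Set
_<V_ = LexLt _≡_ ℤ._<_

_≗V_ : {k : ℕ} → (Fin k → ℤ) → (Fin k → ℤ) → Set
v ≗V w = ∀ i → v i ≡ w i

_≤R_ : {m n : ℕ} → Matrix m n → Matrix m n → Set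
M ≤R N = LexLe _≗V_ _<V_ M N

column : {m n : ℕ} → Matrix m n → Fin n → (Fin m → ℤ)
column M j i = M i j

negRow : {m n : ℕ} → Fin m → Matrix m n → Matrix m n
negRow r M i j with i ≟ r
... | yes _ = - M i j
... | no  _ = M i j

negCol : {m n : ℕ} → Fin n → Matrix m n → Matrix m n
negCol c M i j with j ≟ c
... | yes _ = - M i j
... | no  _ = M i j

swapIdx : {k : ℕ} → Fin k → Fin k → Fin k → Fin k
swapIdx a b x with x ≟ a
... | yes _ = b
... | no  _ with x ≟ b
...   | yes _ = a
...   | no  _ = x

swapRows : {m n : ℕ} → Fin m → Fin m → Matrix m n → Matrix m n
swapRows a b M i j = M (swapIdx a b i) j

swapCols : {m n : ℕ} → Fin n → Fin n → Matrix m n → Matrix m n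
swapCols a b M i j = M i (swapIdx a b j)

data Step {m n : ℕ} (M : Matrix m n) : Matrix m n → Set where
  negRowStep   : (r : Fin m) → Step M (negRow r M)
  negColStep   : (c : Fin n) → Step M (negCol c M)
  swapRowsStep : (a b : Fin m) → Step M (swapRows a b M)
  swapColsStep : (a b : Fin n) → Step M (swapCols a b M)

-- Hadamard equivalence: obtainable by a (possibly empty) finite sequence of
-- elementary operations.  (Each operation is an involution, so this is
-- already symmetric.)
data HadamardEquiv {m n : ℕ} : Matrix m n → Matrix m n → Set where
  done : (M : Matrix m n) → HadamardEquiv M M
  step : {M N P : Matrix m n} → Step M N → HadamardEquiv N P → HadamardEquiv M P

_≗M_ : {m n : ℕ} → Matrix m n → Matrix m n → Set
M ≗M N = ∀ i j → M i j ≡ N i j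

Minimal : {m n : ℕ} → Matrix m n → Set
Minimal M = ∀ N → HadamardEquiv M N → M ≤R N

{-# OPTIONS --safe #-}
module Submission where

-- If a later column d were lexicographically smaller than an earlier column c,
-- swapping the two columns would change the matrix first in the top row where
-- the columns differ, and there, at position c, the smaller entry of column d
-- moves forward.  So the swapped matrix is row-lex smaller, contradicting
-- minimality.

open import Defs
open import Data.Nat using (ℕ; suc; _<_; z≤n; s≤s)
open import Data.Nat.Properties using (<-trans; n<1+n) renaming (<-irrefl to <ℕ-irrefl)
open import Data.Fin using (Fin; zero; suc; toℕ; fromℕ<; _≟_)
open import Data.Fin.Properties using (toℕ-fromℕ<)
open import Data.Integer as ℤ using (ℤ)
open import Data.Integer.Properties using (<-cmp; <-irrefl; <-asym)
open import Data.Product using (_,_)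
open import Data.Sum using (_⊎_; inj₁; inj₂)
open import Data.Unit using (tt)
open import Data.Empty using (⊥-elim)
open import Data.Vec.Functional.Relation.Binary.Pointwise using (Pointwise)
open import Relation.Binary.Definitions
  using (Symmetric; Irreflexive; Asymmetric; Trichotomous; tri<; tri≈; tri>)
open import Relation.Binary.PropositionalEquality using (_≡_; refl; sym; cong; subst)
open import Relation.Nullary using (yes; no; ¬_)

private
  tail : {A : Set} {k : ℕ} → (Fin (suc k) → A) → Fin k → A
  tail v i = v (suc i)

module _ {A : Set} {_≈_ _≺_ : A → A → Set} where

  LexLt⇒LexLe : ∀ {k} {v w : Fin k → A} → LexLt _≈_ _≺_ v w → LexLe _≈_ _≺_ v w
  LexLt⇒LexLe {suc k} (inj₁ v₀≺w₀)        = inj₁ v₀≺w₀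
  LexLt⇒LexLe {suc k} (inj₂ (v₀≈w₀ , lt)) = inj₂ (v₀≈w₀ , LexLt⇒LexLe lt)

  LexLt-intro : ∀ {k} {v w : Fin k → A} (c : Fin k) →
    (∀ i → toℕ i < toℕ c → v i ≈ w i) → v c ≺ w c → LexLt _≈_ _≺_ v w
  LexLt-intro {suc k} zero    prefix≈ vc≺wc = inj₁ vc≺wc
  LexLt-intro {suc k} (suc c) prefix≈ vc≺wc =
    inj₂ (prefix≈ zero (s≤s z≤n) , LexLt-intro c (λ i i<c → prefix≈ (suc i) (s≤s i<c)) vc≺wc)

  LexLe-or-LexLt : Symmetric _≈_ → Trichotomous _≈_ _≺_ →
    ∀ {k} (v w : Fin k → A) → LexLe _≈_ _≺_ v w ⊎ LexLt _≈_ _≺_ w v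
  LexLe-or-LexLt sym≈ compare {ℕ.zero} v w = inj₁ tt
  LexLe-or-LexLt sym≈ compare {suc k}  v w with compare (v zero) (w zero)
  ... | tri< v₀≺w₀ _ _ = inj₁ (inj₁ v₀≺w₀)
  ... | tri> _ _ w₀≺v₀ = inj₂ (inj₁ w₀≺v₀)
  ... | tri≈ _ v₀≈w₀ _ with LexLe-or-LexLt sym≈ compare (tail v) (tail w)
  ...   | inj₁ le = inj₁ (inj₂ (v₀≈w₀ , le))
  ...   | inj₂ lt = inj₂ (inj₂ (sym≈ v₀≈w₀ , lt))

  LexLe-LexLt-contradiction : Symmetric _≈_ → Irreflexive _≈_ _≺_ → Asymmetric _≺_ →
    ∀ {k} {v w : Fin k → A} → LexLe _≈_ _≺_ v w → ¬ LexLt _≈_ _≺_ w v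
  LexLe-LexLt-contradiction sym≈ irr asym {suc k} (inj₁ v₀≺w₀) (inj₁ w₀≺v₀) =
    asym v₀≺w₀ w₀≺v₀
  LexLe-LexLt-contradiction sym≈ irr asym {suc k} (inj₁ v₀≺w₀) (inj₂ (w₀≈v₀ , _)) =
    irr (sym≈ w₀≈v₀) v₀≺w₀
  LexLe-LexLt-contradiction sym≈ irr asym {suc k} (inj₂ (v₀≈w₀ , _)) (inj₁ w₀≺v₀) =
    irr (sym≈ v₀≈w₀) w₀≺v₀
  LexLe-LexLt-contradiction sym≈ irr asym {suc k} {v} {w} (inj₂ (_ , le)) (inj₂ (_ , lt)) =
    LexLe-LexLt-contradiction sym≈ irr asym {v = tail v} {w = tail w} le lt

  LexLt-irreflexive : Irreflexive _≈_ _≺_ →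
    ∀ {k} → Irreflexive (Pointwise _≈_ {k}) (LexLt _≈_ _≺_)
  LexLt-irreflexive irr {suc k} v≈w (inj₁ v₀≺w₀)     = irr (v≈w zero) v₀≺w₀
  LexLt-irreflexive irr {suc k} v≈w (inj₂ (_ , lt)) = LexLt-irreflexive irr (λ i → v≈w (suc i)) lt

  LexLt-asymmetric : Symmetric _≈_ → Irreflexive _≈_ _≺_ → Asymmetric _≺_ →
    ∀ {k} → Asymmetric (LexLt _≈_ _≺_ {k})
  LexLt-asymmetric sym≈ irr asym v<w =
    LexLe-LexLt-contradiction sym≈ irr asym (LexLt⇒LexLe v<w)

≤V-or->V : ∀ {k} (v w : Fin k → ℤ) → v ≤V w ⊎ w <V v
≤V-or->V = LexLe-or-LexLt sym <-cmp

≤R-<R-contradiction : ∀ {m n} {M N : Matrix m n} → M ≤R N → ¬ LexLt _≗V_ _<V_ N M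
≤R-<R-contradiction =
  LexLe-LexLt-contradiction (λ v≗w i → sym (v≗w i)) <V-irreflexive <V-asymmetric
  where
  ≡-irreflexive : Irreflexive _≡_ ℤ._<_
  ≡-irreflexive refl = <-irrefl refl
  <V-irreflexive : ∀ {k} → Irreflexive (_≗V_ {k}) _<V_
  <V-irreflexive = LexLt-irreflexive ≡-irreflexive
  <V-asymmetric : ∀ {k} → Asymmetric (_<V_ {k})
  <V-asymmetric = LexLt-asymmetric sym ≡-irreflexive <-asym

swapIdx-first : ∀ {k} (a b : Fin k) → swapIdx a b a ≡ b
swapIdx-first a b with a ≟ a
... | yes _   = refl
... | no a≢a = ⊥-elim (a≢a refl)

swapIdx-below : ∀ {k} {a b x : Fin k} → toℕ x < toℕ a → toℕ a < toℕ b → swapIdx a b x ≡ x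
swapIdx-below {a = a} {b} {x} x<a a<b with x ≟ a
... | yes refl = ⊥-elim (<ℕ-irrefl refl x<a)
... | no _ with x ≟ b
...   | yes refl = ⊥-elim (<ℕ-irrefl refl (<-trans x<a a<b))
...   | no _     = refl

swapIdx-invariant : ∀ {A : Set} {k} (r : Fin k → A) {a b : Fin k} → r a ≡ r b →
  ∀ x → r (swapIdx a b x) ≡ r x
swapIdx-invariant r {a} {b} ra≡rb x with x ≟ a
... | yes refl = sym ra≡rb
... | no _ with x ≟ b
...   | yes refl = ra≡rb
...   | no _     = refl

swapIdx-LexLt : ∀ {A : Set} {_≺_ : A → A → Set} {k} (r : Fin k → A) {a b : Fin k} →
  toℕ a < toℕ b → r b ≺ r a → LexLt _≡_ _≺_ (λ x → r (swapIdx a b x)) r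
swapIdx-LexLt {_≺_ = _≺_} r {a} {b} a<b rb≺ra =
  LexLt-intro a (λ x x<a → cong r (swapIdx-below x<a a<b))
    (subst (_≺ r a) (cong r (sym (swapIdx-first a b))) rb≺ra)

swapCols-<R : ∀ {m n} (M : Matrix m n) {a b : Fin n} → toℕ a < toℕ b →
  column M b <V column M a → LexLt _≗V_ _<V_ (swapCols a b M) M
swapCols-<R {suc m} M a<b (inj₁ Mb≺Ma) = inj₁ (swapIdx-LexLt (M zero) a<b Mb≺Ma)
swapCols-<R {suc m} M a<b (inj₂ (Mb≡Ma , lt)) =
  inj₂ (swapIdx-invariant (M zero) (sym Mb≡Ma) , swapCols-<R (λ i → M (suc i)) a<b lt)

minimal⇒columns-sorted : ∀ {m n} {M : Matrix m n} → Minimal M →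
  {a b : Fin n} → toℕ a < toℕ b → column M a ≤V column M b
minimal⇒columns-sorted {M = M} minimal {a} {b} a<b with ≤V-or->V (column M a) (column M b)
... | inj₁ Ma≤Mb = Ma≤Mb
... | inj₂ Mb<Ma = ⊥-elim (≤R-<R-contradiction M≤swapped (swapCols-<R M a<b Mb<Ma))
  where
  M≤swapped : M ≤R swapCols a b M
  M≤swapped = minimal _ (step (swapColsStep a b) (done _))

mainTheorem3 : (m n : ℕ) (M : Matrix m n) → Minimal M →
    (j : ℕ) (p : suc j < n) →
    column M (fromℕ< (<-trans (n<1+n j) p)) ≤V column M (fromℕ< p)
mainTheorem3 m n M minimal j p = minimal⇒columns-sorted minimal j<suc-j
  where
  j<suc-j : toℕ (fromℕ< (<-trans (n<1+n j) p)) < toℕ (fromℕ< p)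
  j<suc-j rewrite toℕ-fromℕ< (<-trans (n<1+n j) p) | toℕ-fromℕ< p = n<1+n j
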